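{- Let $(G,\sigma)$ be a signed graph with a fixed linear ordering $<$ of $V(G)$. Then $$P_{G,\sigma}(\mathbf{x})=\sum_{\mathbf{d}}\big(|\sigma EO(\mathbf{d})|-|\sigma OO(\mathbf{d})|\big)\prod_{v\in V(G)}x_v^{d_v},$$ where the sum is over all sequences $\mathbf{d}=(d_v)_{v\in V(G)}$ of nonnegative integers with $\sum_{v\in V(G)}d_v=|E(G)|$.
   Context: A signed graph $(G,\sigma)$ consists of a finite simple graph $G$ and $\sigma\colon E(G)\to\{+1,-1\}$; edges with $\sigma=+1$ are positive. The graph polynomial (with respect to the ordering $<$) is $P_{G,\sigma}(\mathbf{x})=\prod_{uv\in E(G),\,u<v}(x_u-\sigma(uv)x_v)$. For an orientation $D$ of $G$, an oriented edge $(v,u)$ (directed from $v$ to $u$) is $\sigma$-decreasing if $v>u$ and $\sigma(uv)=+1$. $D$ is $\sigma$-even if it has an even number of $\sigma$-decreasing edges and $\sigma$-odd otherwise. For a sequence $\mathbf{d}=(d_v)_{v\in V(G)}$ of nonnegative integers, $\sigma EO(\mathbf{d})$ and $\sigma OO(\mathbf{d})$ denote the sets of $\sigma$-even and $\sigma$-odd orientations of $G$ whose outdegree sequence is $\mathbf{d}$ (outdegree of $v$ equal to $d_v$ for all $v$). -}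

module Defs where

open import Data.Nat as ℕ using (ℕ; zero; suc)
open import Data.Nat.Properties using () renaming (_≟_ to _≟ℕ_)
open import Data.Integer as ℤ using (ℤ; +_; -_)
open import Data.Fin as Fin using (Fin; _<_) renaming (_≟_ to _≟F_)
open import Data.Fin.Properties using (all?)
open import Data.Bool using (Bool; true; false; if_then_else_) renaming (_≟_ to _≟B_)
open import Data.List using (List; []; _∷_; map; concatMap; length; foldr; filter; _++_; upTo)
open import Data.List.Relation.Unary.Unique.Propositional using (Unique)
open import Data.Vec using (Vec; []; _∷_)
open import Data.Product using (Σ; _×_; _,_; proj₁; proj₂)
open import Relation.Nullary using (Dec; yes; no; does)
open import Relation.Binary.PropositionalEquality using (_≡_)

-- Signed graphs on the vertex set Fin n, linearly ordered by the usual
-- order of Fin n.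

data Sign : Set where
  pos neg : Sign

record SEdge (n : ℕ) : Set where
  constructor sedge
  field
    u   : Fin n
    v   : Fin n
    u<v : u < v
    sgn : Sign
open SEdge public

endpoints : ∀ {n} → SEdge n → Fin n × Fin n
endpoints e = u e , v e

-- A signed (finite simple) graph: a list of edges, each stored with its
-- smaller endpoint first (so no loops), and no two edges with the same
-- pair of endpoints (so no multiple edges).
record SignedGraph (n : ℕ) : Set where
  constructor signedGraph
  field
    edges  : List (SEdge n)
    simple : Unique (map endpoints edges)
open SignedGraph public

-- Orientations.  An orientation of the edge list es is a vector of
-- Booleans, one per edge: for edge uv (u < v), true means u → v and
-- false means v → u.

Orientation : ∀ {n} → List (SEdge n) → Set
Orientation es = Vec Bool (length es)

outdeg : ∀ {n} (es : List (SEdge n)) → Orientation es → Fin n → ℕ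
outdeg []       []       w = 0
outdeg (e ∷ es) (b ∷ bs) w =
  (if does ((if b then u e else v e) ≟F w) then 1 else 0)
  ℕ.+ outdeg es bs w

-- number of σ-decreasing oriented edges: an oriented edge (x → y) is
-- σ-decreasing iff x > y and σ(xy) = +1.  For a stored edge uv with u < v
-- this happens iff it is oriented v → u (b = false) and the sign is pos.
isDecreasing : Bool → Sign → ℕ
isDecreasing false pos = 1
isDecreasing _     _   = 0

numDecreasing : ∀ {n} (es : List (SEdge n)) → Orientation es → ℕ
numDecreasing []       []       = 0
numDecreasing (e ∷ es) (b ∷ bs) = isDecreasing b (sgn e) ℕ.+ numDecreasing es bs

isEven : ℕ → Bool
isEven zero          = true
isEven (suc zero)    = false
isEven (suc (suc k)) = isEven k

allVecs : (m : ℕ) → List (Vec Bool m)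
allVecs zero    = [] ∷ []
allVecs (suc m) = concatMap (λ bs → (true ∷ bs) ∷ (false ∷ bs) ∷ []) (allVecs m)

_≟seq_ : ∀ {n} (d e : Fin n → ℕ) → Dec (∀ i → d i ≡ e i)
d ≟seq e = all? (λ i → d i ≟ℕ e i)

withOutdeg : ∀ {n} (es : List (SEdge n)) → (Fin n → ℕ) → List (Orientation es)
withOutdeg es d = filter (λ o → outdeg es o ≟seq d) (allVecs (length es))

σEO : ∀ {n} → SignedGraph n → (Fin n → ℕ) → ℕ
σEO G d = length (filter (λ o → isEven (numDecreasing (edges G) o) ≟B true)
                         (withOutdeg (edges G) d))

σOO : ∀ {n} → SignedGraph n → (Fin n → ℕ) → ℕ
σOO G d = length (filter (λ o → isEven (numDecreasing (edges G) o) ≟B false)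
                         (withOutdeg (edges G) d))

-- Polynomials in ℤ[x_0, …, x_{n-1}] as finite formal sums of terms
-- c · x^e, with e : Fin n → ℕ an exponent vector.

Poly : ℕ → Set
Poly n = List (ℤ × (Fin n → ℕ))

coeff : ∀ {n} → Poly n → (Fin n → ℕ) → ℤ
coeff []            d = + 0
coeff ((c , e) ∷ p) d = (if does (e ≟seq d) then c else + 0) ℤ.+ coeff p d

_≈P_ : ∀ {n} → Poly n → Poly n → Set
p ≈P q = ∀ d → coeff p d ≡ coeff q d

_*P_ : ∀ {n} → Poly n → Poly n → Poly n
p *P q = concatMap (λ t → map (λ s → (proj₁ t ℤ.* proj₁ s , λ i → proj₂ t i ℕ.+ proj₂ s i)) q) p

oneP : ∀ {n} → Poly n
oneP = (+ 1 , λ _ → 0) ∷ []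

unitExp : ∀ {n} → Fin n → Fin n → ℕ
unitExp w i = if does (w ≟F i) then 1 else 0

signℤ : Sign → ℤ
signℤ pos = + 1
signℤ neg = - (+ 1)

edgeFactor : ∀ {n} → SEdge n → Poly n
edgeFactor e = (+ 1 , unitExp (u e)) ∷ (- signℤ (sgn e) , unitExp (v e)) ∷ []

graphPoly : ∀ {n} → SignedGraph n → Poly n
graphPoly G = foldr (λ e p → edgeFactor e *P p) oneP (edges G)

monomial : ∀ {n} → (Fin n → ℕ) → Poly n
monomial d = (+ 1 , d) ∷ []

scaleP : ∀ {n} → ℤ → Poly n → Poly n
scaleP c p = map (λ t → (c ℤ.* proj₁ t , proj₂ t)) p

sumP : ∀ {n} → List (Poly n) → Poly n
sumP = foldr _++_ []

compositions : (n m : ℕ) → List (Fin n → ℕ)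
compositions zero    zero    = (λ ()) ∷ []
compositions zero    (suc m) = []
compositions (suc n) m       = concatMap (λ k → map (λ d → cons k d) (compositions n (m ℕ.∸ k)))
                                         (upTo (suc m))
  where
  cons : ℕ → (Fin n → ℕ) → Fin (suc n) → ℕ
  cons k d Fin.zero    = k
  cons k d (Fin.suc i) = d i

-- Multiplying out the edge factors x_u − σ(uv) x_v picks one endpoint of every edge, i.e. an
-- orientation (the picked endpoint is the tail), and yields the monomial of its outdegree sequence.
-- The coefficient is −1 exactly when x_v is picked from a positive edge, which is exactly when the
-- edge is σ-decreasing, so the term of an orientation D carries the sign (−1)^(#σ-decreasing edges).
-- Collecting the orientations with outdegree sequence d gives |σEO(d)| − |σOO(d)|.  On the other
-- side each sequence with sum |E(G)| occurs exactly once among the compositions, and a sequence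
-- with any other sum is the outdegree sequence of no orientation.
module Submission where

open import Defs
open import Data.Nat.Properties using (_≟_; _<?_; +-0-commutativeMonoid)
open import Algebra.Properties.CommutativeMonoid.Sum +-0-commutativeMonoid
  using (sum; sum-cong-≗; sum-replicate-zero) renaming (∑-distrib-+ to sum-distrib-+)
open import Data.Bool using (Bool; true; false; _∧_; if_then_else_) renaming (_≟_ to _≟B_)
open import Data.Fin using (Fin; zero; suc)
open import Data.Integer using (ℤ; +_; -_; _+_; _-_; _*_)
open import Data.Product using (_,_; proj₁; proj₂)
open import Data.Integer.Properties
  using (+-identityˡ; +-identityʳ; +-assoc; *-identityˡ; *-identityʳ; *-zeroʳ; *-assoc; *-distribˡ-+; pos-+)
open import Data.Integer.Tactic.RingSolver using (solve-∀)
open import Data.List using (List; []; _∷_; _++_; map; concat; concatMap; filter; length; foldr; upTo)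
open import Data.List.Properties using (map-upTo)
open import Data.Nat as ℕ using (ℕ; _∸_)
open import Data.Vec using (Vec; []; _∷_)
open import Data.Vec.Functional using (Vector; tail; zipWith) renaming (_∷_ to _∷ᶠ_)
open import Function using (_∘_)
open import Level using (Level)
open import Relation.Binary.PropositionalEquality using (_≡_; _≢_; _≗_; refl; sym; trans; cong; cong₂; module ≡-Reasoning)
open import Relation.Nullary using (¬_; Dec; yes; no; does)
open import Relation.Nullary.Decidable using (dec-true; dec-false)
open import Relation.Unary using (Pred; Decidable)
open ≡-Reasoning

private
  variable
    n : ℕ
    A B : Set
    ℓ : Level

∑ : List A → (A → ℤ) → ℤ
∑ []       f = + 0
∑ (x ∷ xs) f = f x + ∑ xs f

∑-cong : (xs : List A) {f g : A → ℤ} → (∀ x → f x ≡ g x) → ∑ xs f ≡ ∑ xs g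
∑-cong []       f≗g = refl
∑-cong (x ∷ xs) f≗g = cong₂ _+_ (f≗g x) (∑-cong xs f≗g)

∑-zero : (xs : List A) {f : A → ℤ} → (∀ x → f x ≡ + 0) → ∑ xs f ≡ + 0
∑-zero []       f≗0 = refl
∑-zero (x ∷ xs) f≗0 = cong₂ _+_ (f≗0 x) (∑-zero xs f≗0)

∑-++ : (xs ys : List A) (f : A → ℤ) → ∑ (xs ++ ys) f ≡ ∑ xs f + ∑ ys f
∑-++ []       ys f = sym (+-identityˡ (∑ ys f))
∑-++ (x ∷ xs) ys f =
  trans (cong (λ s → f x + s) (∑-++ xs ys f)) (sym (+-assoc (f x) (∑ xs f) (∑ ys f)))

∑-concat : (xss : List (List A)) (f : A → ℤ) → ∑ (concat xss) f ≡ ∑ xss (λ xs → ∑ xs f)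
∑-concat []         f = refl
∑-concat (xs ∷ xss) f = trans (∑-++ xs (concat xss) f) (cong (λ s → ∑ xs f + s) (∑-concat xss f))

∑-map : (g : A → B) (xs : List A) (f : B → ℤ) → ∑ (map g xs) f ≡ ∑ xs (f ∘ g)
∑-map g []       f = refl
∑-map g (x ∷ xs) f = cong (λ s → f (g x) + s) (∑-map g xs f)

∑-concatMap : (g : A → List B) (xs : List A) (f : B → ℤ) →
              ∑ (concatMap g xs) f ≡ ∑ xs (λ x → ∑ (g x) f)
∑-concatMap g xs f = trans (∑-concat (map g xs) f) (∑-map g xs (λ ys → ∑ ys f))

∑-distrib-+ : (xs : List A) (f g : A → ℤ) → ∑ xs (λ x → f x + g x) ≡ ∑ xs f + ∑ xs g
∑-distrib-+ []       f g = refl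
∑-distrib-+ (x ∷ xs) f g =
  trans (cong (λ s → f x + g x + s) (∑-distrib-+ xs f g)) (interchange (f x) (g x) (∑ xs f) (∑ xs g))
  where
  interchange : ∀ a b c d → a + b + (c + d) ≡ a + c + (b + d)
  interchange = solve-∀

∑-*ˡ : (xs : List A) (c : ℤ) (f : A → ℤ) → ∑ xs (λ x → c * f x) ≡ c * ∑ xs f
∑-*ˡ []       c f = sym (*-zeroʳ c)
∑-*ˡ (x ∷ xs) c f =
  trans (cong (λ s → c * f x + s) (∑-*ˡ xs c f)) (sym (*-distribˡ-+ c (f x) (∑ xs f)))

∑-comm : (xs : List A) (ys : List B) (h : A → B → ℤ) →
         ∑ xs (λ x → ∑ ys (h x)) ≡ ∑ ys (λ y → ∑ xs (λ x → h x y))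
∑-comm []       ys h = sym (∑-zero ys (λ _ → refl))
∑-comm (x ∷ xs) ys h =
  trans (cong (λ s → ∑ ys (h x) + s) (∑-comm xs ys h))
        (sym (∑-distrib-+ ys (h x) (λ y → ∑ xs (λ x → h x y))))

𝟙 : Bool → ℤ
𝟙 true  = + 1
𝟙 false = + 0

𝟙-∧ : ∀ a b → 𝟙 (a ∧ b) ≡ 𝟙 a * 𝟙 b
𝟙-∧ true  b = sym (*-identityˡ (𝟙 b))
𝟙-∧ false b = refl

if-then-0≡*𝟙 : ∀ b (c : ℤ) → (if b then c else + 0) ≡ c * 𝟙 b
if-then-0≡*𝟙 true  c = sym (*-identityʳ c)
if-then-0≡*𝟙 false c = sym (*-zeroʳ c)

∑-filter : {P : Pred A ℓ} (P? : Decidable P) (f : A → ℤ) (xs : List A) →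
           ∑ (filter P? xs) f ≡ ∑ xs (λ x → f x * 𝟙 (does (P? x)))
∑-filter P? f []       = refl
∑-filter P? f (x ∷ xs) with does (P? x)
... | true  = cong₂ _+_ (sym (*-identityʳ (f x))) (∑-filter P? f xs)
... | false = trans (∑-filter P? f xs) (sym (trans (cong (_+ _) (*-zeroʳ (f x))) (+-identityˡ _)))

∑-upTo-suc : ∀ N (f : ℕ → ℤ) → ∑ (upTo (ℕ.suc N)) f ≡ f 0 + ∑ (upTo N) (f ∘ ℕ.suc)
∑-upTo-suc N f =
  cong (λ s → f 0 + s) (trans (cong (λ ks → ∑ ks f) (sym (map-upTo ℕ.suc N))) (∑-map ℕ.suc (upTo N) f))

∑-upTo-𝟙≡ : ∀ N j (f : ℕ → ℤ) → ∑ (upTo N) (λ k → 𝟙 (does (k ≟ j)) * f k) ≡ 𝟙 (does (j <? N)) * f j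
∑-upTo-𝟙≡ ℕ.zero    j         f = refl
∑-upTo-𝟙≡ (ℕ.suc N) ℕ.zero    f = begin
  ∑ (upTo (ℕ.suc N)) (λ k → 𝟙 (does (k ≟ 0)) * f k)
    ≡⟨ ∑-upTo-suc N (λ k → 𝟙 (does (k ≟ 0)) * f k) ⟩
  + 1 * f 0 + ∑ (upTo N) (λ _ → + 0)
    ≡⟨ cong (λ s → + 1 * f 0 + s) (∑-zero (upTo N) (λ _ → refl)) ⟩
  + 1 * f 0 + + 0
    ≡⟨ +-identityʳ (+ 1 * f 0) ⟩
  + 1 * f 0 ∎
∑-upTo-𝟙≡ (ℕ.suc N) (ℕ.suc j) f = begin
  ∑ (upTo (ℕ.suc N)) (λ k → 𝟙 (does (k ≟ ℕ.suc j)) * f k)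
    ≡⟨ ∑-upTo-suc N (λ k → 𝟙 (does (k ≟ ℕ.suc j)) * f k) ⟩
  + 0 + ∑ (upTo N) (λ k → 𝟙 (does (k ≟ j)) * f (ℕ.suc k))
    ≡⟨ +-identityˡ _ ⟩
  ∑ (upTo N) (λ k → 𝟙 (does (k ≟ j)) * f (ℕ.suc k))
    ≡⟨ ∑-upTo-𝟙≡ N j (f ∘ ℕ.suc) ⟩
  𝟙 (does (j <? N)) * f (ℕ.suc j) ∎

δ : Vector ℕ n → Vector ℕ n → ℤ
δ d e = 𝟙 (does (e ≟seq d))

δ-∷ : (d : Vector ℕ (ℕ.suc n)) {e : Vector ℕ (ℕ.suc n)} →
      δ d e ≡ 𝟙 (does (e zero ≟ d zero)) * δ (tail d) (tail e)
δ-∷ d {e} = 𝟙-∧ (does (e zero ≟ d zero)) (does (tail e ≟seq tail d))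

δ-≗ : {d e : Vector ℕ n} → e ≗ d → δ d e ≡ + 1
δ-≗ {d = d} {e} e≗d = cong 𝟙 (dec-true (e ≟seq d) e≗d)

δ-≉ : {d e : Vector ℕ n} → ¬ e ≗ d → δ d e ≡ + 0
δ-≉ {d = d} {e} e≉d = cong 𝟙 (dec-false (e ≟seq d) e≉d)

δ-cong : {d d′ e e′ : Vector ℕ n} → d ≗ d′ → e ≗ e′ → δ d e ≡ δ d′ e′
δ-cong {d = d} {d′} {e} {e′} d≗d′ e≗e′ with e ≟seq d
... | yes e≗d = trans (δ-≗ e≗d) (sym (δ-≗ e′≗d′))
  where
  e′≗d′ : e′ ≗ d′
  e′≗d′ i = trans (sym (e≗e′ i)) (trans (e≗d i) (d≗d′ i))
... | no  e≉d = trans (δ-≉ e≉d) (sym (δ-≉ (e≉d ∘ e′≗d′⇒e≗d)))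
  where
  e′≗d′⇒e≗d : e′ ≗ d′ → e ≗ d
  e′≗d′⇒e≗d e′≗d′ i = trans (e≗e′ i) (trans (e′≗d′ i) (sym (d≗d′ i)))

*δ-cong : (c : Vector ℕ n → ℤ) → (∀ {a b} → a ≗ b → c a ≡ c b) →
          ∀ d e → c e * δ d e ≡ c d * δ d e
*δ-cong c c-cong d e with e ≟seq d
... | yes e≗d = cong (_* δ d e) (c-cong e≗d)
... | no  e≉d rewrite δ-≉ e≉d = trans (*-zeroʳ (c e)) (sym (*-zeroʳ (c d)))

sum-unitExp : (w : Fin n) → sum (unitExp w) ≡ 1
sum-unitExp {ℕ.suc n} zero    = cong ℕ.suc (sum-replicate-zero n)
sum-unitExp           (suc w) = sum-unitExp w

origin : SEdge n → Bool → Fin n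
origin e b = if b then u e else v e

sum-outdeg : (es : List (SEdge n)) (o : Orientation es) → sum (outdeg es o) ≡ length es
sum-outdeg {n} []       []       = sum-replicate-zero n
sum-outdeg     (e ∷ es) (b ∷ bs) =
  trans (sum-distrib-+ (unitExp (origin e b)) (outdeg es bs))
        (cong₂ ℕ._+_ (sum-unitExp (origin e b)) (sum-outdeg es bs))

-- Coefficients are pairings with δ, and by ⟦*P⟧ the pairing of a product is an iterated pairing
-- with shifted weights; this is why the expansion ⟦edgeProduct⟧ is proved for all weights at once.
⟦_⟧ : Poly n → (Vector ℕ n → ℤ) → ℤ
⟦ p ⟧ f = ∑ p (λ t → proj₁ t * f (proj₂ t))

coeff≡⟦⟧δ : (p : Poly n) (d : Vector ℕ n) → coeff p d ≡ ⟦ p ⟧ (δ d)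
coeff≡⟦⟧δ []            d = refl
coeff≡⟦⟧δ ((c , e) ∷ p) d = cong₂ _+_ (if-then-0≡*𝟙 (does (e ≟seq d)) c) (coeff≡⟦⟧δ p d)

⟦*P⟧ : (p q : Poly n) (f : Vector ℕ n → ℤ) →
       ⟦ p *P q ⟧ f ≡ ⟦ p ⟧ (λ a → ⟦ q ⟧ (λ b → f (zipWith ℕ._+_ a b)))
⟦*P⟧ p q f = trans (∑-concatMap _ p _) (∑-cong p pull)
  where
  pull : ∀ t → ∑ (map (λ s → (proj₁ t * proj₁ s , zipWith ℕ._+_ (proj₂ t) (proj₂ s))) q)
                   (λ t′ → proj₁ t′ * f (proj₂ t′))
             ≡ proj₁ t * ⟦ q ⟧ (λ b → f (zipWith ℕ._+_ (proj₂ t) b))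
  pull (c , a) = trans (∑-map _ q _) (trans (∑-cong q (λ s → *-assoc c (proj₁ s) _)) (∑-*ˡ q c _))

⟦sumP⟧ : (ps : List (Poly n)) (f : Vector ℕ n → ℤ) → ⟦ sumP ps ⟧ f ≡ ∑ ps (λ p → ⟦ p ⟧ f)
⟦sumP⟧ ps f = ∑-concat ps _

⟦scaled-monomial⟧ : (c : ℤ) (e : Vector ℕ n) (f : Vector ℕ n → ℤ) →
                    ⟦ scaleP c (monomial e) ⟧ f ≡ c * f e
⟦scaled-monomial⟧ c e f = trans (+-identityʳ _) (cong (_* f e) (*-identityʳ c))

edgeProduct : List (SEdge n) → Poly n
edgeProduct = foldr (λ e p → edgeFactor e *P p) oneP

edgeWeight : SEdge n → Bool → ℤ
edgeWeight e true  = + 1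
edgeWeight e false = - signℤ (sgn e)

boolSign : Bool → ℤ
boolSign true  = + 1
boolSign false = - + 1

boolSign-isEven-suc : ∀ k → boolSign (isEven (ℕ.suc k)) ≡ - + 1 * boolSign (isEven k)
boolSign-isEven-suc ℕ.zero            = refl
boolSign-isEven-suc (ℕ.suc ℕ.zero)    = refl
boolSign-isEven-suc (ℕ.suc (ℕ.suc k)) = boolSign-isEven-suc k

orientationSign : (es : List (SEdge n)) → Orientation es → ℤ
orientationSign es o = boolSign (isEven (numDecreasing es o))

orientationSign-∷ : (e : SEdge n) (es : List (SEdge n)) (b : Bool) (bs : Orientation es) →
                    orientationSign (e ∷ es) (b ∷ bs) ≡ edgeWeight e b * orientationSign es bs
orientationSign-∷ e                 es true  bs = sym (*-identityˡ _)
orientationSign-∷ (sedge _ _ _ pos) es false bs = boolSign-isEven-suc (numDecreasing es bs)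
orientationSign-∷ (sedge _ _ _ neg) es false bs = sym (*-identityˡ _)

∑-allVecs-suc : ∀ m (f : Vec Bool (ℕ.suc m) → ℤ) →
                ∑ (allVecs (ℕ.suc m)) f ≡ ∑ (allVecs m) (λ bs → ∑ (true ∷ false ∷ []) (λ b → f (b ∷ bs)))
∑-allVecs-suc m f = ∑-concatMap _ (allVecs m) f

⟦edgeProduct⟧ : (es : List (SEdge n)) (f : Vector ℕ n → ℤ) →
  ⟦ edgeProduct es ⟧ f ≡ ∑ (allVecs (length es)) (λ o → orientationSign es o * f (outdeg es o))
⟦edgeProduct⟧ []       f = refl
⟦edgeProduct⟧ (e ∷ es) f = begin
  ⟦ edgeFactor e *P edgeProduct es ⟧ f
    ≡⟨ ⟦*P⟧ (edgeFactor e) (edgeProduct es) f ⟩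
  ∑ bools (λ b → edgeWeight e b * ⟦ edgeProduct es ⟧ (shifted b))
    ≡⟨ ∑-cong bools (λ b → cong (edgeWeight e b *_) (⟦edgeProduct⟧ es (shifted b))) ⟩
  ∑ bools (λ b → edgeWeight e b * ∑ os (λ bs → orientationSign es bs * term b bs))
    ≡⟨ ∑-cong bools (λ b → sym (∑-*ˡ os (edgeWeight e b) (λ bs → orientationSign es bs * term b bs))) ⟩
  ∑ bools (λ b → ∑ os (λ bs → edgeWeight e b * (orientationSign es bs * term b bs)))
    ≡⟨ ∑-comm bools os (λ b bs → edgeWeight e b * (orientationSign es bs * term b bs)) ⟩
  ∑ os (λ bs → ∑ bools (λ b → edgeWeight e b * (orientationSign es bs * term b bs)))
    ≡⟨ ∑-cong os (λ bs → ∑-cong bools (λ b → sym (signed-term b bs))) ⟩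
  ∑ os (λ bs → ∑ bools (λ b → orientationSign (e ∷ es) (b ∷ bs) * term b bs))
    ≡⟨ sym (∑-allVecs-suc (length es) _) ⟩
  ∑ (allVecs (length (e ∷ es))) (λ o → orientationSign (e ∷ es) o * f (outdeg (e ∷ es) o)) ∎
  where
  bools : List Bool
  bools = true ∷ false ∷ []
  os : List (Orientation es)
  os = allVecs (length es)
  shifted : Bool → Vector ℕ _ → ℤ
  shifted b a = f (zipWith ℕ._+_ (unitExp (origin e b)) a)
  term : Bool → Orientation es → ℤ
  term b bs = f (outdeg (e ∷ es) (b ∷ bs))
  signed-term : ∀ b bs → orientationSign (e ∷ es) (b ∷ bs) * term b bs
                       ≡ edgeWeight e b * (orientationSign es bs * term b bs)
  signed-term b bs = trans (cong (_* term b bs) (orientationSign-∷ e es b bs))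
                           (*-assoc (edgeWeight e b) (orientationSign es bs) (term b bs))

module _ (g : A → Bool) where
  private
    #true #false : List A → ℕ
    #true  xs = length (filter (λ x → g x ≟B true) xs)
    #false xs = length (filter (λ x → g x ≟B false) xs)

    suc-minus : ∀ a b → + ℕ.suc a - + b ≡ + 1 + (+ a - + b)
    suc-minus a b = trans (cong (_- + b) (pos-+ 1 a)) (+-assoc (+ 1) (+ a) (- + b))

    minus-suc : ∀ a b → + a - + ℕ.suc b ≡ - + 1 + (+ a - + b)
    minus-suc a b = trans (cong (λ s → + a - s) (pos-+ 1 b)) (ring (+ a) (+ b))
      where
      ring : ∀ x y → x - (+ 1 + y) ≡ - + 1 + (x - y)
      ring = solve-∀

  length-filter-true-minus-false : (xs : List A) → + #true xs - + #false xs ≡ ∑ xs (boolSign ∘ g)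
  length-filter-true-minus-false []       = refl
  length-filter-true-minus-false (x ∷ xs) with g x
  ... | true  = trans (suc-minus (#true xs) (#false xs))
                      (cong (λ s → + 1 + s) (length-filter-true-minus-false xs))
  ... | false = trans (minus-suc (#true xs) (#false xs))
                      (cong (λ s → - + 1 + s) (length-filter-true-minus-false xs))

σEO-σOO≡∑ : (G : SignedGraph n) (d : Vector ℕ n) →
  + σEO G d - + σOO G d
    ≡ ∑ (allVecs (length (edges G))) (λ o → orientationSign (edges G) o * δ d (outdeg (edges G) o))
σEO-σOO≡∑ G d =
  trans (length-filter-true-minus-false (λ o → isEven (numDecreasing (edges G) o)) (withOutdeg (edges G) d))
        (∑-filter (λ o → outdeg (edges G) o ≟seq d) (orientationSign (edges G)) (allVecs (length (edges G))))

coeff-graphPoly : (G : SignedGraph n) (d : Vector ℕ n) → coeff (graphPoly G) d ≡ + σEO G d - + σOO G d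
coeff-graphPoly G d =
  trans (coeff≡⟦⟧δ (graphPoly G) d) (trans (⟦edgeProduct⟧ (edges G) (δ d)) (sym (σEO-σOO≡∑ G d)))

σEO-σOO-cong : (G : SignedGraph n) {d d′ : Vector ℕ n} → d ≗ d′ →
               + σEO G d - + σOO G d ≡ + σEO G d′ - + σOO G d′
σEO-σOO-cong G {d} {d′} d≗d′ =
  trans (σEO-σOO≡∑ G d)
        (trans (∑-cong (allVecs (length (edges G))) same-term) (sym (σEO-σOO≡∑ G d′)))
  where
  same-term : ∀ o → orientationSign (edges G) o * δ d (outdeg (edges G) o)
                  ≡ orientationSign (edges G) o * δ d′ (outdeg (edges G) o)
  same-term o = cong (orientationSign (edges G) o *_) (δ-cong d≗d′ (λ _ → refl))

σEO-σOO-outside : (G : SignedGraph n) (d : Vector ℕ n) → sum d ≢ length (edges G) →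
                  + σEO G d - + σOO G d ≡ + 0
σEO-σOO-outside G d sum≢ = trans (σEO-σOO≡∑ G d) (∑-zero (allVecs (length (edges G))) vanishes)
  where
  vanishes : ∀ o → orientationSign (edges G) o * δ d (outdeg (edges G) o) ≡ + 0
  vanishes o = trans (cong (orientationSign (edges G) o *_) (δ-≉ outdeg≉d))
                     (*-zeroʳ (orientationSign (edges G) o))
    where
    outdeg≉d : ¬ outdeg (edges G) o ≗ d
    outdeg≉d o≗d = sum≢ (trans (sym (sum-cong-≗ o≗d)) (sum-outdeg (edges G) o))

𝟙-+≡ : ∀ j s m → 𝟙 (does (j <? ℕ.suc m)) * 𝟙 (does (s ≟ m ∸ j)) ≡ 𝟙 (does (j ℕ.+ s ≟ m))
𝟙-+≡ ℕ.zero    s m         = *-identityˡ _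
𝟙-+≡ (ℕ.suc j) s ℕ.zero    = refl
𝟙-+≡ (ℕ.suc j) s (ℕ.suc m) = 𝟙-+≡ j s m

∑-compositions-δ : ∀ n m (d : Vector ℕ n) → ∑ (compositions n m) (δ d) ≡ 𝟙 (does (sum d ≟ m))
∑-compositions-δ ℕ.zero    ℕ.zero    d = refl
∑-compositions-δ ℕ.zero    (ℕ.suc m) d = refl
∑-compositions-δ (ℕ.suc n) m         d = split _ (λ k e → λ { zero → refl ; (suc i) → refl })
  where
  -- compositions builds its vectors with a function local to its definition, which cannot be
  -- named here; any function agreeing pointwise with _∷ᶠ_ will do.
  split : (cons : ℕ → Vector ℕ n → Vector ℕ (ℕ.suc n)) →
          (∀ k e → cons k e ≗ k ∷ᶠ e) →
          ∑ (concatMap (λ k → map (cons k) (compositions n (m ∸ k))) (upTo (ℕ.suc m))) (δ d)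
            ≡ 𝟙 (does (sum d ≟ m))
  split cons cons≗∷ = begin
    ∑ (concatMap (λ k → map (cons k) (compositions n (m ∸ k))) (upTo (ℕ.suc m))) (δ d)
      ≡⟨ ∑-concatMap (λ k → map (cons k) (compositions n (m ∸ k))) (upTo (ℕ.suc m)) (δ d) ⟩
    ∑ (upTo (ℕ.suc m)) (λ k → ∑ (map (cons k) (compositions n (m ∸ k))) (δ d))
      ≡⟨ ∑-cong (upTo (ℕ.suc m)) split-head ⟩
    ∑ (upTo (ℕ.suc m)) (λ k → 𝟙 (does (k ≟ d zero)) * 𝟙 (does (sum (tail d) ≟ m ∸ k)))
      ≡⟨ ∑-upTo-𝟙≡ (ℕ.suc m) (d zero) (λ k → 𝟙 (does (sum (tail d) ≟ m ∸ k))) ⟩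
    𝟙 (does (d zero <? ℕ.suc m)) * 𝟙 (does (sum (tail d) ≟ m ∸ d zero))
      ≡⟨ 𝟙-+≡ (d zero) (sum (tail d)) m ⟩
    𝟙 (does (sum d ≟ m)) ∎
    where
    split-head : ∀ k → ∑ (map (cons k) (compositions n (m ∸ k))) (δ d)
                     ≡ 𝟙 (does (k ≟ d zero)) * 𝟙 (does (sum (tail d) ≟ m ∸ k))
    split-head k = begin
      ∑ (map (cons k) (compositions n (m ∸ k))) (δ d)
        ≡⟨ ∑-map (cons k) (compositions n (m ∸ k)) (δ d) ⟩
      ∑ (compositions n (m ∸ k)) (δ d ∘ cons k)
        ≡⟨ ∑-cong (compositions n (m ∸ k)) (λ e → trans (δ-cong {d = d} (λ _ → refl) (cons≗∷ k e))
                                                        (δ-∷ d {k ∷ᶠ e})) ⟩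
      ∑ (compositions n (m ∸ k)) (λ e → 𝟙 (does (k ≟ d zero)) * δ (tail d) e)
        ≡⟨ ∑-*ˡ (compositions n (m ∸ k)) (𝟙 (does (k ≟ d zero))) (δ (tail d)) ⟩
      𝟙 (does (k ≟ d zero)) * ∑ (compositions n (m ∸ k)) (δ (tail d))
        ≡⟨ cong (𝟙 (does (k ≟ d zero)) *_) (∑-compositions-δ n (m ∸ k) (tail d)) ⟩
      𝟙 (does (k ≟ d zero)) * 𝟙 (does (sum (tail d) ≟ m ∸ k)) ∎

coeff-∑-compositions : (c : Vector ℕ n → ℤ) → (∀ {a b} → a ≗ b → c a ≡ c b) → ∀ m d →
  coeff (sumP (map (λ e → scaleP (c e) (monomial e)) (compositions n m))) d ≡ c d * 𝟙 (does (sum d ≟ m))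
coeff-∑-compositions {n} c c-cong m d = begin
  coeff (sumP (map term (compositions n m))) d
    ≡⟨ coeff≡⟦⟧δ (sumP (map term (compositions n m))) d ⟩
  ⟦ sumP (map term (compositions n m)) ⟧ (δ d)
    ≡⟨ ⟦sumP⟧ (map term (compositions n m)) (δ d) ⟩
  ∑ (map term (compositions n m)) (λ p → ⟦ p ⟧ (δ d))
    ≡⟨ ∑-map term (compositions n m) (λ p → ⟦ p ⟧ (δ d)) ⟩
  ∑ (compositions n m) (λ e → ⟦ term e ⟧ (δ d))
    ≡⟨ ∑-cong (compositions n m) (λ e → ⟦scaled-monomial⟧ (c e) e (δ d)) ⟩
  ∑ (compositions n m) (λ e → c e * δ d e)
    ≡⟨ ∑-cong (compositions n m) (*δ-cong c c-cong d) ⟩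
  ∑ (compositions n m) (λ e → c d * δ d e)
    ≡⟨ ∑-*ˡ (compositions n m) (c d) (δ d) ⟩
  c d * ∑ (compositions n m) (δ d)
    ≡⟨ cong (c d *_) (∑-compositions-δ n m d) ⟩
  c d * 𝟙 (does (sum d ≟ m)) ∎
  where
  term : Vector ℕ n → Poly n
  term e = scaleP (c e) (monomial e)

lemma2p1 : (n : ℕ) (G : SignedGraph n) →
    graphPoly G ≈P
      sumP (map (λ d → scaleP (+ σEO G d - + σOO G d) (monomial d))
                (compositions n (length (edges G))))
lemma2p1 n G d = begin
  coeff (graphPoly G) d
    ≡⟨ coeff-graphPoly G d ⟩
  c d
    ≡⟨ supported (sum d ≟ m) ⟩
  c d * 𝟙 (does (sum d ≟ m))
    ≡⟨ sym (coeff-∑-compositions c (σEO-σOO-cong G) m d) ⟩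
  coeff (sumP (map (λ e → scaleP (c e) (monomial e)) (compositions n m))) d ∎
  where
  m : ℕ
  m = length (edges G)
  c : Vector ℕ n → ℤ
  c e = + σEO G e - + σOO G e
  supported : (sum≟ : Dec (sum d ≡ m)) → c d ≡ c d * 𝟙 (does sum≟)
  supported (yes _)    = sym (*-identityʳ (c d))
  supported (no  sum≢) = trans (σEO-σOO-outside G d sum≢) (sym (*-zeroʳ (c d)))
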